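{- The inhabitation algorithm for system $\mathcal S_w$ terminates: for every input (a judgement form $\mathtt T(\Gamma,\sigma)$, $\mathtt{TI}(\Gamma,A)$ or $\mathtt H^{x:[\rho]}(\Gamma,\tau)$), every run of the algorithm on that input is finite, and there are only finitely many possible runs (up to the choice of fresh bound variable names).
   Context: $\mathtt I$ denotes $\lambda z.z$. Types: $\sigma,\tau,\rho::=\alpha\mid A\to\tau$, $\alpha$ base types, multiset types $A=[\sigma_i]_{i\in I}$ finite possibly empty multisets ($[\,]$ empty). Environments $\Gamma$ map variables to multiset types, all but finitely many to $[\,]$; $\mathrm{dom}(\Gamma)=\{y:\Gamma(y)\ne[\,]\}$; $(\Gamma+\Delta)(y)=\Gamma(y)\uplus\Delta(y)$; $x{:}A$ maps $x$ to $A$, others to $[\,]$. Inhabitation algorithm for $\mathcal S_w$ (a deductive system; a run on an input is an attempted bottom-up construction of a derivation of a judgement on that input with unknown term): (Abs) from $t\Vdash\mathtt T(\Gamma+x{:}A,\tau)$, $x\notin\mathrm{dom}(\Gamma)$, infer $\lambda x.t\Vdash\mathtt T(\Gamma,A\to\tau)$; (Union) from $(t\Vdash\mathtt T(\Gamma_i,\sigma_i))_{i\in I}$ (same $t$) infer $t\Vdash\mathtt{TI}(+_{i\in I}\Gamma_i,[\sigma_i]_{i\in I})$; (Head$_{>0}$) from $\Gamma=\Gamma_1+\Gamma_2$, $t\Vdash\mathtt H^{x:[A_1\to\dots\to A_n\to B\to\tau]}(\Gamma_1,B\to\tau)$, $u\Vdash\mathtt{TI}(\Gamma_2,B)$, $B\ne[\,]$,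 $n\ge0$, infer $tu\Vdash\mathtt H^{x:[A_1\to\dots\to A_n\to B\to\tau]}(\Gamma,\tau)$; (Head$^{[]}_{>0}$) from $t\Vdash\mathtt H^{x:[A_1\to\dots\to A_n\to[\,]\to\tau]}(\Gamma,[\,]\to\tau)$, $n\ge0$, infer $t\,\mathtt I\Vdash\mathtt H^{x:[A_1\to\dots\to A_n\to[\,]\to\tau]}(\Gamma,\tau)$; (Head$_0$) $x\Vdash\mathtt H^{x:[\tau]}(\Gamma,\tau)$ for any $\Gamma$; (Head) from $t\Vdash\mathtt H^{x:[A_1\to\dots\to A_n\to\tau]}(\Gamma,\tau)$ infer $t\Vdash\mathtt T(\Gamma+x{:}[A_1\to\dots\to A_n\to\tau],\tau)$. -}

module Defs where

open import Data.Nat using (ℕ; _≤_; _≡ᵇ_)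
open import Data.Bool using (if_then_else_)
open import Data.List using (List; []; _∷_; _++_; map; foldr)
open import Data.List.Relation.Unary.All using (All; []; _∷_)
open import Data.List.Relation.Unary.Any using (Any)
open import Data.List.Membership.Propositional using (_∈_)
open import Data.List.Relation.Binary.Permutation.Homogeneous using (Permutation)
open import Data.Product using (Σ; _×_; _,_; proj₁; proj₂; ∃)
open import Data.Empty using (⊥)
open import Data.Sum using (_⊎_)
open import Relation.Nullary using (¬_)
open import Relation.Binary.PropositionalEquality using (_≡_; _≢_)
open import Function.Bundles using (_↔_; Inverse)
open import Function.Construct.Identity using (↔-id)
open import Induction.WellFounded using (Acc)

-- Types.  σ,τ,ρ ::= α | A → τ ,  A a finite multiset of types.
-- A multiset is represented by a list; multiset (and hence type)
-- equality is "permutation up to type equality", defined mutually.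

infixr 7 _⇒_
data Ty : Set where
  base : ℕ → Ty
  _⇒_  : List Ty → Ty → Ty

MTy : Set
MTy = List Ty

infix 4 _≈_ _≋_
data _≈_ : Ty → Ty → Set where
  base : ∀ {a} → base a ≈ base a
  arr  : ∀ {A B σ τ} → Permutation _≈_ A B → σ ≈ τ → (A ⇒ σ) ≈ (B ⇒ τ)

_≋_ : MTy → MTy → Set
A ≋ B = Permutation _≈_ A B

Env : Set
Env = ℕ → MTy

FinSupp : Env → Set
FinSupp Γ = ∃ λ b → ∀ y → b ≤ y → Γ y ≡ []

infix 4 _≐_
_≐_ : Env → Env → Set
Γ ≐ Δ = ∀ y → Γ y ≋ Δ y

infixl 6 _+ᴱ_
_+ᴱ_ : Env → Env → Env
(Γ +ᴱ Δ) y = Γ y ++ Δ y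

emptyᴱ : Env
emptyᴱ y = []

_∶_ : ℕ → MTy → Env
(x ∶ A) y = if y ≡ᵇ x then A else []

sumᴱ : List Env → Env
sumᴱ = foldr _+ᴱ_ emptyᴱ

data Judg : Set where
  T  : Env → Ty → Judg
  TI : Env → MTy → Judg
  H  : ℕ → Ty → Env → Ty → Judg      -- H^{x:[ρ]}(Γ, τ)  written  H x ρ Γ τ

data Tgt : Ty → Ty → Set where
  here  : ∀ {ρ υ} → ρ ≈ υ → Tgt ρ υ
  there : ∀ {A τ υ} → Tgt τ υ → Tgt (A ⇒ τ) υ

NonEmpty : MTy → Set
NonEmpty B = B ≢ []

-- Rule instances of S_w read bottom-up:  Inst J ps  means that some rule
-- has conclusion (of the form) J and premises ps.  The term constructed
-- (λx.t, t, t u, t I, x) is determined by the rule and the premises.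

data Inst : Judg → List Judg → Set where
  abs    : ∀ {Γ A τ x} → Γ x ≡ [] →
           Inst (T Γ (A ⇒ τ)) (T (Γ +ᴱ (x ∶ A)) τ ∷ [])
  union  : ∀ {Γ A} (ps : List (Env × Ty)) →
           Γ ≐ sumᴱ (map proj₁ ps) → A ≡ map proj₂ ps →
           Inst (TI Γ A) (map (λ p → T (proj₁ p) (proj₂ p)) ps)
  headS  : ∀ {x ρ Γ Γ₁ Γ₂ B τ} → Γ ≐ Γ₁ +ᴱ Γ₂ → Tgt ρ (B ⇒ τ) → NonEmpty B →
           Inst (H x ρ Γ τ) (H x ρ Γ₁ (B ⇒ τ) ∷ TI Γ₂ B ∷ [])
  headE  : ∀ {x ρ Γ τ} → Tgt ρ ([] ⇒ τ) →
           Inst (H x ρ Γ τ) (H x ρ Γ ([] ⇒ τ) ∷ [])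
  head0  : ∀ {x ρ Γ τ} → ρ ≈ τ → Inst (H x ρ Γ τ) []
  head   : ∀ {x ρ Γ Γ' τ} → Γ' ≐ Γ +ᴱ (x ∶ (ρ ∷ [])) → Tgt ρ τ →
           Inst (T Γ' τ) (H x ρ Γ τ ∷ [])

Premise : Judg → Judg → Set
Premise J' J = Σ (List Judg) λ ps → Inst J ps × J' ∈ ps

-- A run on input J: a bottom-up attempted construction.
data Run (J : Judg) : Set where
  step  : ∀ {ps} → Inst J ps → All Run ps → Run J
  stuck : (∀ ps → ¬ Inst J ps) → Run J

WfJudg : Judg → Set
WfJudg (T Γ σ)     = FinSupp Γ
WfJudg (TI Γ A)    = FinSupp Γ
WfJudg (H x ρ Γ τ) = FinSupp Γ

Ren : Set
Ren = ℕ ↔ ℕ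

ren : Ren → ℕ → ℕ
ren π = Inverse.to π

JRel : Ren → Judg → Judg → Set
JRel π (T Γ σ)     (T Γ' σ')        = (∀ y → Γ y ≋ Γ' (ren π y)) × σ ≈ σ'
JRel π (TI Γ A)    (TI Γ' A')       = (∀ y → Γ y ≋ Γ' (ren π y)) × A ≋ A'
JRel π (H x ρ Γ τ) (H x' ρ' Γ' τ')  =
  ren π x ≡ x' × ρ ≈ ρ' × (∀ y → Γ y ≋ Γ' (ren π y)) × τ ≈ τ'
JRel π _ _ = ⊥

Relevant : Judg → ℕ → Set
Relevant (T Γ σ)     y = Γ y ≢ []
Relevant (TI Γ A)    y = Γ y ≢ []
Relevant (H x ρ Γ τ) y = (Γ y ≢ []) ⊎ y ≡ x

Agree : Judg → Ren → Ren → Set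
Agree J π π' = ∀ y → Relevant J y → ren π y ≡ ren π' y

-- Sim π r r' : r' is obtained from r by renaming, where the renaming
-- π is fixed on the variables of the current goal and may only be
-- changed (when passing to a premise) on variables not occurring in
-- the goal, i.e. on the fresh variables bound by (Abs).
data Sim : {J J' : Judg} → Ren → Run J → Run J' → Set
data SimAll (J : Judg) : {ps ps' : List Judg} → Ren → All Run ps → All Run ps' → Set

data Sim where
  step  : ∀ {J J' ps ps' π} {i : Inst J ps} {i' : Inst J' ps'}
            {rs : All Run ps} {rs' : All Run ps'} →
          JRel π J J' → SimAll J π rs rs' → Sim π (step i rs) (step i' rs')
  stuck : ∀ {J J' π} {f : ∀ ps → ¬ Inst J ps} {f' : ∀ ps → ¬ Inst J' ps} →
          JRel π J J' → Sim π (stuck f) (stuck f')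

data SimAll J where
  []  : ∀ {π} → SimAll J π [] []
  _∷_ : ∀ {π K K' ps ps'} {r : Run K} {r' : Run K'}
          {rs : All Run ps} {rs' : All Run ps'} →
        (Σ Ren λ π' → Agree J π π' × Sim π' r r') →
        SimAll J π rs rs' → SimAll J π (r ∷ rs) (r' ∷ rs')

_≅ᴿ_ : ∀ {J} → Run J → Run J → Set
_≅ᴿ_ {J} r r' = Σ Ren λ π → Agree J (↔-id ℕ) π × Sim π r r'

-- Termination: a goal whose environment vanishes from b on is measured by the total size of
-- the types in its environment plus the size of its type (|ρ| − |τ| for H^{x:[ρ]}(Γ,τ)),
-- doubled and shifted by a parity offset. Every rule instance lowers this measure (Abs after
-- moving b past its fresh variable), so the premise relation is well founded.
-- Finiteness: up to renaming, a goal has only finitely many rule instances, built from splits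
-- of the environment and of multisets, permutations of multisets and the suffixes
-- A₁ → … → Aₙ → υ of ρ; the fresh variable of Abs can always be swapped with b without moving
-- the variables of the goal. By well-founded induction every run is the stuck run or one of
-- these instances followed by one run, from a finite list, for each premise.

module Submission where

open import Defs
open import Data.Nat using (ℕ; zero; suc; _≤_; _<_; _≟_; _≤?_; _+_; _∸_; _*_; s≤s)
open import Data.Nat.Properties
  using (≤-refl; ≤-reflexive; ≤-trans; <-≤-trans; ≰⇒>; <⇒≤; <⇒≢; >⇒≢; n≤1+n; m<n⇒m<1+n; m<1+n⇒m<n∨m≡n;
         m≤m+n; m≤n+m; +-assoc; +-identityʳ; +-suc; +-mono-≤; +-monoʳ-≤; +-mono-≤-<; +-monoʳ-<;
         *-suc; *-monoʳ-≤; *-monoʳ-<; m∸n≤m; ∸-monoʳ-<; m+n≤o⇒m≤o∸n; +-commutativeSemigroup; allUpTo?)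
open import Data.List using (List; []; _∷_; _++_; [_]; map; concatMap; downFrom)
open import Data.List.Properties using (++-assoc; ++-identityʳ)
open import Data.List.Relation.Unary.All as All using (All; []; _∷_)
import Data.List.Relation.Unary.All.Properties as All
open import Data.List.Relation.Unary.Any as Any using (Any; here; there)
open import Data.List.Relation.Unary.Any.Properties using (¬Any[]; map⁺; concat⁺; ++⁺ˡ; ++⁺ʳ; ++⁻)
open import Data.List.Membership.Propositional using (find)
open import Data.List.Membership.Propositional.Properties using (∈-∃++; ∈-downFrom⁺)
open import Data.List.Relation.Binary.Pointwise as Pointwise using (Pointwise; []; _∷_)
open import Data.List.Relation.Binary.Permutation.Homogeneous using (refl; prep; swap; trans)
open import Data.Product using (Σ; Σ-syntax; ∃; ∃₂; _×_; _,_; proj₁; proj₂)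
open import Data.Empty using (⊥-elim)
open import Data.Sum using (inj₁; inj₂)
open import Relation.Nullary using (¬_; Dec; yes; no)
open import Relation.Nullary.Decidable using (map′; _×-dec_; dec-true; dec-false)
open import Relation.Binary.Bundles using (Setoid)
open import Relation.Binary.PropositionalEquality as ≡ using (_≡_; _≢_; cong; cong₂; subst; sym)
open import Function.Base using (case_of_; _∘_)
open import Function.Bundles using (Inverse; Injection; mk↔ₛ′)
open import Function.Properties.Inverse using (Inverse⇒Injection)
open import Function.Construct.Identity using (↔-id)
open import Function.Construct.Symmetry using (↔-sym)
open import Function.Construct.Composition using (_↔-∘_)
open import Induction.WellFounded using (Acc; acc)
open import Data.Nat.Induction using (<-wellFounded)
open import Algebra.Properties.CommutativeSemigroup +-commutativeSemigroup using (interchange; x∙yz≈y∙xz)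

mutual
  ≈-refl : ∀ {σ} → σ ≈ σ
  ≈-refl {base a} = base
  ≈-refl {A ⇒ σ}  = arr (refl ≈-pointwise-refl) ≈-refl

  ≈-pointwise-refl : ∀ {A} → Pointwise _≈_ A A
  ≈-pointwise-refl {[]}    = []
  ≈-pointwise-refl {σ ∷ A} = ≈-refl ∷ ≈-pointwise-refl

mutual
  ≈-sym : ∀ {σ τ} → σ ≈ τ → τ ≈ σ
  ≈-sym base      = base
  ≈-sym (arr p q) = arr (≋-sym p) (≈-sym q)

  ≋-sym : ∀ {A B} → A ≋ B → B ≋ A
  ≋-sym (refl ps)    = refl (≈-pointwise-sym ps)
  ≋-sym (prep e p)   = prep (≈-sym e) (≋-sym p)
  ≋-sym (swap e f p) = swap (≈-sym f) (≈-sym e) (≋-sym p)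
  ≋-sym (trans p q)  = trans (≋-sym q) (≋-sym p)

  ≈-pointwise-sym : ∀ {A B} → Pointwise _≈_ A B → Pointwise _≈_ B A
  ≈-pointwise-sym []      = []
  ≈-pointwise-sym (e ∷ p) = ≈-sym e ∷ ≈-pointwise-sym p

≈-trans : ∀ {σ τ υ} → σ ≈ τ → τ ≈ υ → σ ≈ υ
≈-trans base      base        = base
≈-trans (arr p q) (arr p' q') = arr (trans p p') (≈-trans q q')

≈-setoid : Setoid _ _
≈-setoid = record
  { Carrier       = Ty
  ; _≈_           = _≈_
  ; isEquivalence = record { refl = ≈-refl ; sym = ≈-sym ; trans = ≈-trans }
  }

open import Data.List.Relation.Binary.Permutation.Setoid ≈-setoid
  using (↭-refl; ↭-reflexive)
open import Data.List.Relation.Binary.Permutation.Setoid.Properties ≈-setoid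
  using (shift; dropMiddleElement; Any-resp-↭; xs↭ys⇒|xs|≡|ys|)
  renaming (++⁺ to ≋-++⁺; ++⁺ˡ to ≋-++⁺ˡ)

≋-refl : ∀ {A} → A ≋ A
≋-refl = ↭-refl

≋-trans : ∀ {A B C} → A ≋ B → B ≋ C → A ≋ C
≋-trans = trans

≋-reflexive : ∀ {A B} → A ≡ B → A ≋ B
≋-reflexive = ↭-reflexive

≋-[]-inv : ∀ {A} → A ≋ [] → A ≡ []
≋-[]-inv {[]}    _ = ≡.refl
≋-[]-inv {_ ∷ _} p with () ← xs↭ys⇒|xs|≡|ys| p

[]-≋-inv : ∀ {A} → [] ≋ A → A ≡ []
[]-≋-inv p = ≋-[]-inv (≋-sym p)

∷-≋-∈≈ : ∀ {σ A B} → σ ∷ A ≋ B → Any (σ ≈_) B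
∷-≋-∈≈ p = Any-resp-↭ (λ e f → ≈-trans f e) p (here ≈-refl)

≋-[-]-inv : ∀ {A σ} → A ≋ [ σ ] → ∃ λ ρ → A ≡ [ ρ ] × ρ ≈ σ
≋-[-]-inv {[]}        p with () ← xs↭ys⇒|xs|≡|ys| p
≋-[-]-inv {_ ∷ _ ∷ _} p with () ← xs↭ys⇒|xs|≡|ys| p
≋-[-]-inv {ρ ∷ []}    p with here e ← ∷-≋-∈≈ p = ρ , ≡.refl , e

++-≡-[]-inv : ∀ (A B : MTy) → A ++ B ≡ [] → A ≡ [] × B ≡ []
++-≡-[]-inv [] B e = ≡.refl , e

++-≋-[]-inv : ∀ {C A B} → C ≋ A ++ B → C ≡ [] → A ≡ [] × B ≡ []
++-≋-[]-inv {A = A} {B} p ≡.refl = ++-≡-[]-inv A B ([]-≋-inv p)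

∈≈-split : ∀ {σ B} → Any (σ ≈_) B → ∃₂ λ U V → ∃ λ ρ → B ≡ U ++ ρ ∷ V × σ ≈ ρ
∈≈-split a with ρ , ρ∈B , e ← find a with U , V , ≡.refl ← ∈-∃++ ρ∈B = U , V , ρ , ≡.refl , e

∷-≋-drop : ∀ {σ A U ρ V} → σ ≈ ρ → σ ∷ A ≋ U ++ ρ ∷ V → A ≋ U ++ V
∷-≋-drop e p = dropMiddleElement [] _ (trans (prep (≈-sym e) ≋-refl) p)

∷-≋-insert : ∀ {σ U ρ V} → σ ≈ ρ → U ++ ρ ∷ V ≋ σ ∷ U ++ V
∷-≋-insert e = shift (≈-sym e) _ _

mutual
  _≈?_ : (σ τ : Ty) → Dec (σ ≈ τ)
  base a  ≈? base b  = map′ (λ { ≡.refl → base }) (λ { base → ≡.refl }) (a ≟ b)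
  base _  ≈? (_ ⇒ _) = no λ ()
  (_ ⇒ _) ≈? base _  = no λ ()
  (A ⇒ σ) ≈? (B ⇒ τ) = map′ (λ (p , q) → arr p q) (λ { (arr p q) → p , q }) ((A ≋? B) ×-dec (σ ≈? τ))

  _≋?_ : (A B : MTy) → Dec (A ≋ B)
  []      ≋? []      = yes ≋-refl
  []      ≋? (_ ∷ _) = no λ p → case xs↭ys⇒|xs|≡|ys| p of λ ()
  (σ ∷ A) ≋? B with Any.any? (σ ≈?_) B
  ... | no σ∉B = no λ p → σ∉B (∷-≋-∈≈ p)
  ... | yes σ∈B with U , V , ρ , ≡.refl , e ← ∈≈-split σ∈B =
    map′ (λ p → trans (prep e p) (≋-sym (∷-≋-insert ≈-refl))) (∷-≋-drop e) (A ≋? (U ++ V))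

-- Finite enumerations

concatMap⁺ : ∀ {A B : Set} {P : A → Set} {Q : B → Set} {f : A → List B} {xs} →
             (∀ {x} → P x → Any Q (f x)) → Any P xs → Any Q (concatMap f xs)
concatMap⁺ g = concat⁺ ∘ map⁺ ∘ Any.map g

ifYes : ∀ {P X : Set} → Dec P → (P → List X) → List X
ifYes (yes p) f = f p
ifYes (no  _) f = []

ifYes-complete : ∀ {P X : Set} {Q : X → Set} {f : P → List X} (d : Dec P) → P →
                 (∀ p → Any Q (f p)) → Any Q (ifYes d f)
ifYes-complete (yes p) _ q = q p
ifYes-complete (no ¬p) p _ = ⊥-elim (¬p p)

Tgt-resp-≈ : ∀ {ρ ρ' υ υ'} → ρ ≈ ρ' → υ ≈ υ' → Tgt ρ υ → Tgt ρ' υ'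
Tgt-resp-≈ e f (here g)            = here (≈-trans (≈-sym e) (≈-trans g f))
Tgt-resp-≈ (arr _ q) f (there t) = there (Tgt-resp-≈ q f t)

Tgt? : (ρ τ : Ty) → Dec (Tgt ρ τ)
Tgt? ρ τ with ρ ≈? τ
... | yes e = yes (here e)
Tgt? (base _) τ | no ρ≉τ = no λ { (here e) → ρ≉τ e }
Tgt? (A ⇒ σ)  τ | no ρ≉τ =
  map′ there (λ { (here e) → ⊥-elim (ρ≉τ e) ; (there t) → t }) (Tgt? σ τ)

ArrowTarget : Ty → Set
ArrowTarget ρ = Σ[ (B , τ) ∈ MTy × Ty ] Tgt ρ (B ⇒ τ)

arrowTargets : (ρ : Ty) → List (ArrowTarget ρ)
arrowTargets (base _) = []
arrowTargets (A ⇒ τ)  = ((A , τ) , here ≈-refl) ∷ map (λ (c , t) → c , there t) (arrowTargets τ)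

arrowTargets-complete : ∀ {ρ B τ} → Tgt ρ (B ⇒ τ) →
  Any (λ ((B' , τ') , _) → B' ≋ B × τ' ≈ τ) (arrowTargets ρ)
arrowTargets-complete (here (arr p q)) = here (p , q)
arrowTargets-complete (there t)        = there (map⁺ (arrowTargets-complete t))

Split : MTy → Set
Split C = Σ[ (A , B) ∈ MTy × MTy ] C ≋ A ++ B

addLeft : ∀ {σ C} → Split C → Split (σ ∷ C)
addLeft ((A , B) , p) = (_ ∷ A , B) , prep ≈-refl p

addRight : ∀ {σ C} → Split C → Split (σ ∷ C)
addRight ((A , B) , p) = (A , _ ∷ B) , trans (prep ≈-refl p) (≋-sym (shift ≈-refl A B))

splits : (C : MTy) → List (Split C)
splits []      = [ ([] , []) , ≋-refl ]
splits (σ ∷ C) = map addLeft (splits C) ++ map addRight (splits C)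

splits-complete : ∀ C {A B} → C ≋ A ++ B → Any (λ ((A' , B') , _) → A ≋ A' × B ≋ B') (splits C)
splits-complete [] {A} {B} p with ≡.refl , ≡.refl ← ++-≡-[]-inv A B ([]-≋-inv p) = here (≋-refl , ≋-refl)
splits-complete (σ ∷ C) {A} {B} p with ++⁻ A (∷-≋-∈≈ p)
... | inj₁ σ∈A with U , V , ρ , ≡.refl , e ← ∈≈-split σ∈A =
  ++⁺ˡ (map⁺ (Any.map (λ (q , r) → ≋-trans (∷-≋-insert e) (prep ≈-refl q) , r)
                      (splits-complete C rest)))
  where
  rest : C ≋ (U ++ V) ++ B
  rest = ≋-trans (∷-≋-drop e (≋-trans p (≋-reflexive (++-assoc U (ρ ∷ V) B))))
                 (≋-reflexive (sym (++-assoc U V B)))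
... | inj₂ σ∈B with U , V , ρ , ≡.refl , e ← ∈≈-split σ∈B =
  ++⁺ʳ _ (map⁺ (Any.map (λ (q , r) → q , ≋-trans (∷-≋-insert e) (prep ≈-refl r))
                        (splits-complete C rest)))
  where
  rest : C ≋ A ++ (U ++ V)
  rest = ≋-trans (∷-≋-drop e (≋-trans p (≋-reflexive (sym (++-assoc A U (ρ ∷ V))))))
                 (≋-reflexive (++-assoc A U V))

insertions : (σ : Ty) (A : MTy) → List (Σ MTy (σ ∷ A ≋_))
insertions σ []      = [ [ σ ] , ≋-refl ]
insertions σ (τ ∷ A) = (σ ∷ τ ∷ A , ≋-refl) ∷
  map (λ (B , p) → τ ∷ B , trans (swap ≈-refl ≈-refl ≋-refl) (prep ≈-refl p)) (insertions σ A)

insertions-complete : ∀ σ U V → Any (λ (B , _) → B ≡ U ++ σ ∷ V) (insertions σ (U ++ V))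
insertions-complete σ []      []      = here ≡.refl
insertions-complete σ []      (_ ∷ _) = here ≡.refl
insertions-complete σ (τ ∷ U) V       = there (map⁺ (Any.map (cong (τ ∷_)) (insertions-complete σ U V)))

permutations : (A : MTy) → List (Σ MTy (A ≋_))
permutations []      = [ [] , ≋-refl ]
permutations (σ ∷ A) =
  concatMap (λ (B , p) → map (λ (C , q) → C , trans (prep ≈-refl p) q) (insertions σ B)) (permutations A)

Pointwise-++-inv : ∀ U {V W} → Pointwise _≈_ (U ++ V) W →
  ∃₂ λ U' V' → W ≡ U' ++ V' × Pointwise _≈_ U U' × Pointwise _≈_ V V'
Pointwise-++-inv []      q       = [] , _ , ≡.refl , [] , q
Pointwise-++-inv (_ ∷ U) (e ∷ q) with U' , V' , ≡.refl , q₁ , q₂ ← Pointwise-++-inv U q =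
  _ ∷ U' , V' , ≡.refl , e ∷ q₁ , q₂

permutations-complete : ∀ B {A} → A ≋ B → Any (λ (C , _) → Pointwise _≈_ A C) (permutations B)
permutations-complete []      p with ≡.refl ← ≋-[]-inv p = here []
permutations-complete (σ ∷ B) p with U , V , ρ , ≡.refl , e ← ∈≈-split (∷-≋-∈≈ (≋-sym p)) =
  concatMap⁺ (λ {c} q → map⁺ (insert {c} q))
             (permutations-complete B (dropMiddleElement U [] (trans p (prep e ≋-refl))))
  where
  insert : ∀ {c : Σ MTy (B ≋_)} → Pointwise _≈_ (U ++ V) (proj₁ c) →
           Any (λ (D , _) → Pointwise _≈_ (U ++ ρ ∷ V) D) (insertions σ (proj₁ c))
  insert q with U' , V' , ≡.refl , q₁ , q₂ ← Pointwise-++-inv U q =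
    Any.map (λ { ≡.refl → Pointwise.++⁺ q₁ (≈-sym e ∷ q₂) }) (insertions-complete σ U' V')

Bounded : Env → ℕ → Set
Bounded Γ b = ∀ y → b ≤ y → Γ y ≡ []

bounded-< : ∀ {Γ b} → Bounded Γ b → ∀ x → Γ x ≢ [] → x < b
bounded-< {b = b} bd x Γx≢[] with b ≤? x
... | yes b≤x = ⊥-elim (Γx≢[] (bd x b≤x))
... | no  b≰x = ≰⇒> b≰x

bounded-+ᴱ-inv : ∀ {Γ Γ₁ Γ₂ b} → Γ ≐ Γ₁ +ᴱ Γ₂ → Bounded Γ b → Bounded Γ₁ b × Bounded Γ₂ b
bounded-+ᴱ-inv e bd = (λ y b≤y → proj₁ (++-≋-[]-inv (e y) (bd y b≤y)))
                    , (λ y b≤y → proj₂ (++-≋-[]-inv (e y) (bd y b≤y)))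

∶-≡ : ∀ x A → (x ∶ A) x ≡ A
∶-≡ x A rewrite dec-true (x ≟ x) ≡.refl = ≡.refl

∶-≢ : ∀ x A y → y ≢ x → (x ∶ A) y ≡ []
∶-≢ x A y y≢x rewrite dec-false (y ≟ x) y≢x = ≡.refl

update : Env → ℕ → MTy → Env
update Γ x A y with y ≟ x
... | yes _ = A
... | no  _ = Γ y

update-≡ : ∀ Γ x A → update Γ x A x ≡ A
update-≡ Γ x A with x ≟ x
... | yes _   = ≡.refl
... | no  x≢x = ⊥-elim (x≢x ≡.refl)

update-≢ : ∀ Γ x A y → y ≢ x → update Γ x A y ≡ Γ y
update-≢ Γ x A y y≢x with y ≟ x
... | yes y≡x = ⊥-elim (y≢x y≡x)
... | no  _   = ≡.refl

update-split : ∀ {Γ x A B} → Γ x ≋ A ++ B → Γ ≐ update Γ x A +ᴱ (x ∶ B)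
update-split {Γ} {x} {A} {B} p y with y ≟ x
... | yes ≡.refl rewrite ∶-≡ y B = p
... | no  y≢x    rewrite ∶-≢ x B y y≢x = ≋-reflexive (sym (++-identityʳ (Γ y)))

record EnvSplit (b : ℕ) (Γ : Env) : Set where
  constructor envSplit
  field
    envˡ envʳ    : Env
    split-below : ∀ z → z < b → Γ z ≋ envˡ z ++ envʳ z
    boundedˡ     : Bounded envˡ b
    boundedʳ     : Bounded envʳ b
open EnvSplit

extendSplit : ∀ {b Γ} → EnvSplit b Γ → Split (Γ b) → EnvSplit (suc b) Γ
extendSplit {b} {Γ} (envSplit Γ₁ Γ₂ p bd₁ bd₂) ((A₁ , A₂) , q) =
  envSplit (update Γ₁ b A₁) (update Γ₂ b A₂) p' (bounded-update bd₁) (bounded-update bd₂)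
  where
  p' : ∀ z → z < suc b → Γ z ≋ update Γ₁ b A₁ z ++ update Γ₂ b A₂ z
  p' z z<1+b with m<1+n⇒m<n∨m≡n z<1+b
  ... | inj₂ ≡.refl rewrite update-≡ Γ₁ z A₁ | update-≡ Γ₂ z A₂ = q
  ... | inj₁ z<b rewrite update-≢ Γ₁ b A₁ z (<⇒≢ z<b) | update-≢ Γ₂ b A₂ z (<⇒≢ z<b) = p z z<b
  bounded-update : ∀ {Δ A} → Bounded Δ b → Bounded (update Δ b A) (suc b)
  bounded-update {Δ} {A} bd z b<z rewrite update-≢ Δ b A z (>⇒≢ b<z) = bd z (<⇒≤ b<z)

envSplits : (b : ℕ) (Γ : Env) → List (EnvSplit b Γ)
envSplits zero    Γ = [ envSplit emptyᴱ emptyᴱ (λ _ ()) (λ _ _ → ≡.refl) (λ _ _ → ≡.refl) ]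
envSplits (suc b) Γ = concatMap (λ c → map (extendSplit c) (splits (Γ b))) (envSplits b Γ)

EnvSplit-≐ : ∀ {b Γ} → Bounded Γ b → (c : EnvSplit b Γ) → Γ ≐ envˡ c +ᴱ envʳ c
EnvSplit-≐ {b} bd c y with b ≤? y
... | no  b≰y = split-below c y (≰⇒> b≰y)
... | yes b≤y rewrite bd y b≤y | boundedˡ c y b≤y | boundedʳ c y b≤y = ≋-refl

SplitBelow : ∀ {b Γ} → Env → Env → EnvSplit b Γ → Set
SplitBelow {b} Δ₁ Δ₂ c = ∀ z → z < b → Δ₁ z ≋ envˡ c z × Δ₂ z ≋ envʳ c z

envSplits-complete : ∀ b Γ {Δ₁ Δ₂} → (∀ z → z < b → Γ z ≋ Δ₁ z ++ Δ₂ z) →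
  Any (SplitBelow Δ₁ Δ₂) (envSplits b Γ)
envSplits-complete zero    Γ h = here (λ _ ())
envSplits-complete (suc b) Γ {Δ₁} {Δ₂} h =
  concatMap⁺ (λ {c} hc → map⁺ (Any.map (λ {d} → extend c hc {d}) (splits-complete (Γ b) (h b ≤-refl))))
             (envSplits-complete b Γ (λ z z<b → h z (m<n⇒m<1+n z<b)))
  where
  extend : ∀ c → SplitBelow Δ₁ Δ₂ c → ∀ {d} → Δ₁ b ≋ proj₁ (proj₁ d) × Δ₂ b ≋ proj₂ (proj₁ d) →
           SplitBelow Δ₁ Δ₂ (extendSplit c d)
  extend c hc {(A₁ , A₂) , _} hd z z<1+b with m<1+n⇒m<n∨m≡n z<1+b
  ... | inj₂ ≡.refl rewrite update-≡ (envˡ c) z A₁ | update-≡ (envʳ c) z A₂ = hd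
  ... | inj₁ z<b rewrite update-≢ (envˡ c) b A₁ z (<⇒≢ z<b) | update-≢ (envʳ c) b A₂ z (<⇒≢ z<b) = hc z z<b

ren⁻¹ : Ren → ℕ → ℕ
ren⁻¹ π = Inverse.from π

ren-ren⁻¹ : ∀ π z → ren π (ren⁻¹ π z) ≡ z
ren-ren⁻¹ π = Inverse.strictlyInverseˡ π

ren⁻¹-ren : ∀ π y → ren⁻¹ π (ren π y) ≡ y
ren⁻¹-ren π = Inverse.strictlyInverseʳ π

ren-injective : ∀ π {y z} → ren π y ≡ ren π z → y ≡ z
ren-injective π = Injection.injective (Inverse⇒Injection π)

infix 4 _≐⟨_⟩_
record _≐⟨_⟩_ (Γ₀ : Env) (π : Ren) (Γ : Env) : Set where
  constructor mk≐⟨⟩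
  field at : ∀ y → Γ₀ y ≋ Γ (ren π y)
open _≐⟨_⟩_

≐⟨⟩-+ᴱ : ∀ {Γ₀ Δ₀ Γ Δ π} → Γ₀ ≐⟨ π ⟩ Γ → Δ₀ ≐⟨ π ⟩ Δ → Γ₀ +ᴱ Δ₀ ≐⟨ π ⟩ Γ +ᴱ Δ
≐⟨⟩-+ᴱ p q = mk≐⟨⟩ λ y → ≋-++⁺ (at p y) (at q y)

≐⟨⟩-∶ : ∀ {x₀ A₀ x A π} → ren π x₀ ≡ x → A₀ ≋ A → (x₀ ∶ A₀) ≐⟨ π ⟩ (x ∶ A)
≐⟨⟩-∶ {x₀} {A₀} {x} {A} {π} ≡.refl A₀≋A = mk≐⟨⟩ pointwise
  where
  pointwise : ∀ y → (x₀ ∶ A₀) y ≋ (x ∶ A) (ren π y)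
  pointwise y with y ≟ x₀
  ... | yes ≡.refl rewrite ∶-≡ y A₀ | ∶-≡ (ren π y) A = A₀≋A
  ... | no  y≢x₀   rewrite ∶-≢ x₀ A₀ y y≢x₀ | ∶-≢ x A (ren π y) (y≢x₀ ∘ ren-injective π) = ≋-refl

≐⟨⟩-≢[] : ∀ {Γ₀ Γ π} → Γ₀ ≐⟨ π ⟩ Γ → ∀ {y} → Γ₀ y ≢ [] → Γ (ren π y) ≢ []
≐⟨⟩-≢[] p {y} Γ₀y≢[] Γπy≡[] = Γ₀y≢[] (≋-[]-inv (≋-trans (at p y) (≋-reflexive Γπy≡[])))

≐⟨⟩-sym : ∀ {Γ₀ Γ π} → Γ₀ ≐⟨ π ⟩ Γ → Γ ≐⟨ ↔-sym π ⟩ Γ₀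
≐⟨⟩-sym {Γ₀} {Γ} {π} p = mk≐⟨⟩ λ y →
  ≋-sym (subst (λ z → Γ₀ (ren⁻¹ π y) ≋ Γ z) (ren-ren⁻¹ π y) (at p (ren⁻¹ π y)))

≐⟨⟩-update : ∀ {Γ₀' Γ' Γ₀ x₀ B₀ A} (π : Ren) → Γ₀' ≐⟨ π ⟩ Γ' → Γ₀' ≐ Γ₀ +ᴱ (x₀ ∶ B₀) → Γ₀ x₀ ≋ A →
  Γ₀ ≐⟨ π ⟩ update Γ' (ren π x₀) A
≐⟨⟩-update {Γ₀' = Γ₀'} {Γ'} {Γ₀} {x₀} {B₀} {A} π Γ₀'≐Γ' e Γ₀x₀≋A = mk≐⟨⟩ pointwise
  where
  pointwise : ∀ y → Γ₀ y ≋ update Γ' (ren π x₀) A (ren π y)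
  pointwise y with y ≟ x₀
  ... | yes ≡.refl rewrite update-≡ Γ' (ren π y) A = Γ₀x₀≋A
  ... | no  y≢x₀   rewrite update-≢ Γ' (ren π x₀) A (ren π y) (y≢x₀ ∘ ren-injective π) =
    ≋-trans (≋-reflexive (sym (≡.trans (cong (Γ₀ y ++_) (∶-≢ x₀ B₀ y y≢x₀)) (++-identityʳ (Γ₀ y)))))
            (≋-trans (≋-sym (e y)) (at Γ₀'≐Γ' y))

transpose : ℕ → ℕ → ℕ → ℕ
transpose a c z with z ≟ a | z ≟ c
... | yes _ | _     = c
... | no  _ | yes _ = a
... | no  _ | no  _ = z

transpose-other : ∀ {a c z} → z ≢ a → z ≢ c → transpose a c z ≡ z
transpose-other {a} {c} {z} z≢a z≢c with z ≟ a | z ≟ c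
... | yes z≡a | _       = ⊥-elim (z≢a z≡a)
... | no  _   | yes z≡c = ⊥-elim (z≢c z≡c)
... | no  _   | no  _   = ≡.refl

transpose-a : ∀ a c → transpose a c a ≡ c
transpose-a a c with a ≟ a
... | yes _   = ≡.refl
... | no  a≢a = ⊥-elim (a≢a ≡.refl)

transpose-c : ∀ a c → transpose a c c ≡ a
transpose-c a c with c ≟ a | c ≟ c
... | yes c≡a | _       = c≡a
... | no  _   | yes _   = ≡.refl
... | no  _   | no  c≢c = ⊥-elim (c≢c ≡.refl)

transpose-involutive : ∀ a c z → transpose a c (transpose a c z) ≡ z
transpose-involutive a c z with z ≟ a | z ≟ c
... | yes ≡.refl | _          = transpose-c z c
... | no  _      | yes ≡.refl = transpose-a a z
... | no  z≢a    | no  z≢c    = transpose-other z≢a z≢c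

transposition : ℕ → ℕ → Ren
transposition a c =
  mk↔ₛ′ (transpose a c) (transpose a c) (transpose-involutive a c) (transpose-involutive a c)

transpose-preserves-env : ∀ {Γ : Env} {a c} → Γ a ≡ [] → Γ c ≡ [] → ∀ z → Γ (transpose a c z) ≡ Γ z
transpose-preserves-env {Γ} {a} {c} Γa≡[] Γc≡[] z with z ≟ a | z ≟ c
... | yes ≡.refl | _          = ≡.trans Γc≡[] (sym Γa≡[])
... | no  _      | yes ≡.refl = ≡.trans Γa≡[] (sym Γc≡[])
... | no  _      | no  _      = ≡.refl

≐⟨⟩-transpose : ∀ {Γ₀ Γ : Env} {π a c} → Γ₀ ≐⟨ π ⟩ Γ → Γ a ≡ [] → Γ c ≡ [] →
  Γ₀ ≐⟨ transposition a c ↔-∘ π ⟩ Γ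
≐⟨⟩-transpose {Γ = Γ} {π} p Γa≡[] Γc≡[] = mk≐⟨⟩ λ y →
  ≋-trans (at p y) (≋-reflexive (sym (transpose-preserves-env {Γ} Γa≡[] Γc≡[] (ren π y))))

envSplits-complete-renamed : ∀ {b Γ Γ₀ Δ₁ Δ₂} → Bounded Γ b → (π : Ren) → Γ₀ ≐⟨ π ⟩ Γ → Γ₀ ≐ Δ₁ +ᴱ Δ₂ →
  Any (λ c → Δ₁ ≐⟨ π ⟩ envˡ c × Δ₂ ≐⟨ π ⟩ envʳ c) (envSplits b Γ)
envSplits-complete-renamed {b} {Γ} {Γ₀} {Δ₁} {Δ₂} bd π Γ₀≐Γ Γ₀≐Δ =
  Any.map (λ {c} → renamed {c}) (envSplits-complete b Γ split-back)
  where
  split-back : ∀ z → z < b → Γ z ≋ Δ₁ (ren⁻¹ π z) ++ Δ₂ (ren⁻¹ π z)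
  split-back z _ = ≋-trans (≋-reflexive (cong Γ (sym (ren-ren⁻¹ π z))))
                           (≋-trans (≋-sym (at Γ₀≐Γ (ren⁻¹ π z))) (Γ₀≐Δ (ren⁻¹ π z)))
  renamed : ∀ {c} → SplitBelow (Δ₁ ∘ ren⁻¹ π) (Δ₂ ∘ ren⁻¹ π) c →
            Δ₁ ≐⟨ π ⟩ envˡ c × Δ₂ ≐⟨ π ⟩ envʳ c
  renamed {c} hc = mk≐⟨⟩ (λ y → proj₁ (both y)) , mk≐⟨⟩ (λ y → proj₂ (both y))
    where
    both : ∀ y → Δ₁ y ≋ envˡ c (ren π y) × Δ₂ y ≋ envʳ c (ren π y)
    both y with b ≤? ren π y
    ... | no b≰πy = subst (λ x → Δ₁ x ≋ envˡ c (ren π y) × Δ₂ x ≋ envʳ c (ren π y))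
                          (ren⁻¹-ren π y) (hc (ren π y) (≰⇒> b≰πy))
    ... | yes b≤πy
      with Δ₁y≡[] , Δ₂y≡[] ← ++-≋-[]-inv {A = Δ₁ y} (≋-trans (≋-sym (at Γ₀≐Γ y)) (Γ₀≐Δ y))
                                                  (bd (ren π y) b≤πy)
      rewrite Δ₁y≡[] | Δ₂y≡[] | boundedˡ c (ren π y) b≤πy | boundedʳ c (ren π y) b≤πy = ≋-refl , ≋-refl

-- The termination measure

mutual
  size : Ty → ℕ
  size (base _) = 0
  size (A ⇒ τ)  = suc (sizeᴹ A + size τ)

  sizeᴹ : MTy → ℕ
  sizeᴹ []      = 0
  sizeᴹ (σ ∷ A) = suc (size σ) + sizeᴹ A

mutual
  size-≈ : ∀ {σ τ} → σ ≈ τ → size σ ≡ size τ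
  size-≈ base      = ≡.refl
  size-≈ (arr p q) = cong suc (cong₂ _+_ (sizeᴹ-≋ p) (size-≈ q))

  sizeᴹ-≋ : ∀ {A B} → A ≋ B → sizeᴹ A ≡ sizeᴹ B
  sizeᴹ-≋ (refl ps)    = sizeᴹ-pointwise ps
  sizeᴹ-≋ (prep e p)   = cong₂ _+_ (cong suc (size-≈ e)) (sizeᴹ-≋ p)
  sizeᴹ-≋ (swap {ys = B} {x′ = σ} {y′ = τ} e f p) = ≡.trans
    (cong₂ _+_ (cong suc (size-≈ e)) (cong₂ _+_ (cong suc (size-≈ f)) (sizeᴹ-≋ p)))
    (x∙yz≈y∙xz (suc (size σ)) (suc (size τ)) (sizeᴹ B))
  sizeᴹ-≋ (trans p q)  = ≡.trans (sizeᴹ-≋ p) (sizeᴹ-≋ q)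

  sizeᴹ-pointwise : ∀ {A B} → Pointwise _≈_ A B → sizeᴹ A ≡ sizeᴹ B
  sizeᴹ-pointwise []      = ≡.refl
  sizeᴹ-pointwise (e ∷ p) = cong₂ _+_ (cong suc (size-≈ e)) (sizeᴹ-pointwise p)

sizeᴹ-++ : ∀ A B → sizeᴹ (A ++ B) ≡ sizeᴹ A + sizeᴹ B
sizeᴹ-++ []      B = ≡.refl
sizeᴹ-++ (σ ∷ A) B = ≡.trans (cong (suc (size σ) +_) (sizeᴹ-++ A B)) (sym (+-assoc (suc (size σ)) _ _))

Tgt-size : ∀ {ρ υ} → Tgt ρ υ → size υ ≤ size ρ
Tgt-size (here e)            = ≤-reflexive (sym (size-≈ e))
Tgt-size {A ⇒ τ} (there t) = ≤-trans (Tgt-size t) (m≤n+m (size τ) (suc (sizeᴹ A)))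

envSize : ℕ → Env → ℕ
envSize zero    Γ = 0
envSize (suc b) Γ = envSize b Γ + sizeᴹ (Γ b)

envSize-+ᴱ : ∀ b {Γ Γ₁ Γ₂} → Γ ≐ Γ₁ +ᴱ Γ₂ → envSize b Γ ≡ envSize b Γ₁ + envSize b Γ₂
envSize-+ᴱ zero    e = ≡.refl
envSize-+ᴱ (suc b) {Γ} {Γ₁} {Γ₂} e = begin
  envSize b Γ + sizeᴹ (Γ b)
    ≡⟨ cong₂ _+_ (envSize-+ᴱ b e) (≡.trans (sizeᴹ-≋ (e b)) (sizeᴹ-++ (Γ₁ b) (Γ₂ b))) ⟩
  (envSize b Γ₁ + envSize b Γ₂) + (sizeᴹ (Γ₁ b) + sizeᴹ (Γ₂ b))
    ≡⟨ interchange (envSize b Γ₁) (envSize b Γ₂) (sizeᴹ (Γ₁ b)) (sizeᴹ (Γ₂ b)) ⟩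
  (envSize b Γ₁ + sizeᴹ (Γ₁ b)) + (envSize b Γ₂ + sizeᴹ (Γ₂ b)) ∎
  where open ≡.≡-Reasoning

envSize-+ᴱ-≤ˡ : ∀ b {Γ Γ₁ Γ₂} → Γ ≐ Γ₁ +ᴱ Γ₂ → envSize b Γ₁ ≤ envSize b Γ
envSize-+ᴱ-≤ˡ b e rewrite envSize-+ᴱ b e = m≤m+n _ _

envSize-+ᴱ-≤ʳ : ∀ b {Γ Γ₁ Γ₂} → Γ ≐ Γ₁ +ᴱ Γ₂ → envSize b Γ₂ ≤ envSize b Γ
envSize-+ᴱ-≤ʳ b e rewrite envSize-+ᴱ b e = m≤n+m _ _

envSize-empty : ∀ b Γ → (∀ z → z < b → Γ z ≡ []) → envSize b Γ ≡ 0
envSize-empty zero    Γ h = ≡.refl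
envSize-empty (suc b) Γ h
  rewrite envSize-empty b Γ (λ z z<b → h z (m<n⇒m<1+n z<b)) | h b ≤-refl = ≡.refl

envSize-beyond : ∀ k b Γ → Bounded Γ b → envSize (k + b) Γ ≡ envSize b Γ
envSize-beyond zero    b Γ bd = ≡.refl
envSize-beyond (suc k) b Γ bd
  rewrite envSize-beyond k b Γ bd | bd (k + b) (m≤n+m b k) = +-identityʳ _

envSize-∶ : ∀ b x A → x < b → envSize b (x ∶ A) ≡ sizeᴹ A
envSize-∶ (suc b) x A x<1+b with m<1+n⇒m<n∨m≡n x<1+b
... | inj₂ ≡.refl rewrite ∶-≡ x A | envSize-empty x (x ∶ A) (λ z z<x → ∶-≢ x A z (<⇒≢ z<x)) = ≡.refl
... | inj₁ x<b rewrite ∶-≢ x A b (>⇒≢ x<b) | envSize-∶ b x A x<b = +-identityʳ _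

env : Judg → Env
env (T Γ _)     = Γ
env (TI Γ _)    = Γ
env (H _ _ Γ _) = Γ

-- The TI premise of Head_{>0} need not be smaller than its goal in size; the parity offset
-- (odd for TI, even for T and H) makes it smaller in measure.
measure : ℕ → Judg → ℕ
measure b (T Γ σ)     = 2 + 2 * (envSize b Γ + size σ)
measure b (TI Γ A)    = 1 + 2 * (envSize b Γ + sizeᴹ A)
measure b (H _ ρ Γ τ) = 2 + 2 * (envSize b Γ + (size ρ ∸ size τ))

even<even : ∀ {m n} → m < n → 2 + 2 * m < 2 + 2 * n
even<even m<n = s≤s (s≤s (*-monoʳ-< 2 m<n))

even<odd : ∀ {m n} → m < n → 2 + 2 * m < 1 + 2 * n
even<odd {m} m<n = s≤s (≤-trans (≤-reflexive (sym (*-suc 2 m))) (*-monoʳ-≤ 2 m<n))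

odd<even : ∀ {m n} → m ≤ n → 1 + 2 * m < 2 + 2 * n
odd<even m≤n = s≤s (s≤s (*-monoʳ-≤ 2 m≤n))

record Smaller (b : ℕ) (J K : Judg) : Set where
  constructor smaller
  field
    bound     : ℕ
    bounded   : Bounded (env K) bound
    decreases : measure bound K < measure b J

abs-smaller : ∀ {b Γ A τ x} → Bounded Γ b → Γ x ≡ [] → Smaller b (T Γ (A ⇒ τ)) (T (Γ +ᴱ (x ∶ A)) τ)
abs-smaller {b} {Γ} {A} {τ} {x} bd _ = smaller (suc x + b) bounded (even<even size<)
  where
  x<b' : x < suc x + b
  x<b' = s≤s (m≤m+n x b)
  bounded : Bounded (Γ +ᴱ (x ∶ A)) (suc x + b)
  bounded y b'≤y
    rewrite bd y (≤-trans (m≤n+m b (suc x)) b'≤y) | ∶-≢ x A y (>⇒≢ (<-≤-trans x<b' b'≤y)) = ≡.refl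
  size≡ : envSize (suc x + b) (Γ +ᴱ (x ∶ A)) ≡ envSize b Γ + sizeᴹ A
  size≡ = ≡.trans (envSize-+ᴱ (suc x + b) (λ _ → ≋-refl))
                  (cong₂ _+_ (envSize-beyond (suc x) b Γ bd) (envSize-∶ (suc x + b) x A x<b'))
  size< : envSize (suc x + b) (Γ +ᴱ (x ∶ A)) + size τ < envSize b Γ + suc (sizeᴹ A + size τ)
  size< rewrite size≡ | +-assoc (envSize b Γ) (sizeᴹ A) (size τ) = +-monoʳ-< (envSize b Γ) ≤-refl

union-premises-smaller : ∀ b ps {Γ} → Bounded Γ b → Γ ≐ sumᴱ (map proj₁ ps) →
  All (λ (Δ , σ) → Bounded Δ b × envSize b Δ + size σ < envSize b Γ + sizeᴹ (map proj₂ ps)) ps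
union-premises-smaller b []              bd e = []
union-premises-smaller b ((Δ , σ) ∷ ps) bd e =
  (bounded-Δ , +-mono-≤-< (envSize-+ᴱ-≤ˡ b e) (m≤m+n (suc (size σ)) (sizeᴹ (map proj₂ ps))))
  ∷ All.map (λ (bd' , lt) → bd' , <-≤-trans lt (+-mono-≤ (envSize-+ᴱ-≤ʳ b e) (m≤n+m _ (suc (size σ)))))
            (union-premises-smaller b ps bounded-rest (λ _ → ≋-refl))
  where
  bounded-Δ : Bounded Δ b
  bounded-Δ = proj₁ (bounded-+ᴱ-inv e bd)
  bounded-rest : Bounded (sumᴱ (map proj₁ ps)) b
  bounded-rest = proj₂ (bounded-+ᴱ-inv e bd)

head-smaller : ∀ {b Γ' Γ x ρ τ} → Bounded Γ' b → Γ' ≐ Γ +ᴱ (x ∶ [ ρ ]) →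
  Smaller b (T Γ' τ) (H x ρ Γ τ)
head-smaller {b} {Γ'} {Γ} {x} {ρ} {τ} bd e = smaller b (proj₁ (bounded-+ᴱ-inv e bd)) (even<even size<)
  where
  x<b : x < b
  x<b = bounded-< bd x λ Γ'x≡[] →
    case ≡.trans (sym (∶-≡ x [ ρ ])) (proj₂ (++-≋-[]-inv (e x) Γ'x≡[])) of λ ()
  size≡ : envSize b Γ' ≡ envSize b Γ + suc (size ρ + 0)
  size≡ = ≡.trans (envSize-+ᴱ b e) (cong (envSize b Γ +_) (envSize-∶ b x [ ρ ] x<b))
  size< : envSize b Γ + (size ρ ∸ size τ) < envSize b Γ' + size τ
  size< rewrite size≡ | +-identityʳ (size ρ) | +-suc (envSize b Γ) (size ρ) =
    ≤-trans (s≤s (+-monoʳ-≤ (envSize b Γ) (m∸n≤m (size ρ) (size τ)))) (m≤m+n _ _)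

app-smaller : ∀ {b x ρ Γ Γ₁ Γ₂ B τ} → Bounded Γ b → Γ ≐ Γ₁ +ᴱ Γ₂ → Tgt ρ (B ⇒ τ) →
  Smaller b (H x ρ Γ τ) (H x ρ Γ₁ (B ⇒ τ)) × Smaller b (H x ρ Γ τ) (TI Γ₂ B)
app-smaller {b} {ρ = ρ} {B = B} {τ} bd e t =
  smaller b (proj₁ (bounded-+ᴱ-inv e bd)) (even<even
    (+-mono-≤-< (envSize-+ᴱ-≤ˡ b e) (∸-monoʳ-< (s≤s (m≤n+m (size τ) (sizeᴹ B))) B⇒τ≤ρ))) ,
  smaller b (proj₂ (bounded-+ᴱ-inv e bd)) (odd<even
    (+-mono-≤ (envSize-+ᴱ-≤ʳ b e) (m+n≤o⇒m≤o∸n (sizeᴹ B) (≤-trans (n≤1+n _) B⇒τ≤ρ))))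
  where
  B⇒τ≤ρ : suc (sizeᴹ B + size τ) ≤ size ρ
  B⇒τ≤ρ = Tgt-size t

app[]-smaller : ∀ {b x ρ Γ τ} → Bounded Γ b → Tgt ρ ([] ⇒ τ) → Smaller b (H x ρ Γ τ) (H x ρ Γ ([] ⇒ τ))
app[]-smaller {b} {Γ = Γ} bd t =
  smaller b bd (even<even (+-monoʳ-< (envSize b Γ) (∸-monoʳ-< ≤-refl (Tgt-size t))))

premises-smaller : ∀ {J ps} b → Bounded (env J) b → Inst J ps → All (Smaller b J) ps
premises-smaller b bd (abs Γx≡[])         = abs-smaller bd Γx≡[] ∷ []
premises-smaller b bd (union ps e ≡.refl) =
  All.map⁺ (All.map (λ (bd' , lt) → smaller b bd' (even<odd lt)) (union-premises-smaller b ps bd e))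
premises-smaller b bd (headS e t _)       = let s₁ , s₂ = app-smaller bd e t in s₁ ∷ s₂ ∷ []
premises-smaller b bd (headE t)           = app[]-smaller bd t ∷ []
premises-smaller b bd (head0 _)           = []
premises-smaller b bd (head e _)          = head-smaller bd e ∷ []

accessible : ∀ {J b} → Bounded (env J) b → Acc _<_ (measure b J) → Acc Premise J
accessible {b = b} bd (acc rs) = acc λ (_ , i , K∈ps) →
  let smaller _ bd' lt = All.lookup (premises-smaller b bd i) K∈ps in accessible bd' (rs lt)

-- Rule instances up to renaming

-- JRel with the multiset of a TI judgement compared pointwise, because the premises of
-- Union follow the order of that multiset and runs are compared premise by premise.
data StrictJRel (π : Ren) : Judg → Judg → Set where
  T  : ∀ {Γ Γ' σ σ'} → Γ ≐⟨ π ⟩ Γ' → σ ≈ σ' → StrictJRel π (T Γ σ) (T Γ' σ')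
  TI : ∀ {Γ Γ' A A'} → Γ ≐⟨ π ⟩ Γ' → Pointwise _≈_ A A' → StrictJRel π (TI Γ A) (TI Γ' A')
  H  : ∀ {x ρ Γ τ ρ' Γ' τ'} → ρ ≈ ρ' → Γ ≐⟨ π ⟩ Γ' → τ ≈ τ' →
       StrictJRel π (H x ρ Γ τ) (H (ren π x) ρ' Γ' τ')

StrictJRel-refl : ∀ J → StrictJRel (↔-id ℕ) J J
StrictJRel-refl (T Γ σ)     = T (mk≐⟨⟩ λ _ → ≋-refl) ≈-refl
StrictJRel-refl (TI Γ A)    = TI (mk≐⟨⟩ λ _ → ≋-refl) ≈-pointwise-refl
StrictJRel-refl (H x ρ Γ τ) = H ≈-refl (mk≐⟨⟩ λ _ → ≋-refl) ≈-refl

StrictJRel-sym : ∀ {π J₀ J} → StrictJRel π J₀ J → StrictJRel (↔-sym π) J J₀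
StrictJRel-sym (T p σ≈σ')  = T (≐⟨⟩-sym p) (≈-sym σ≈σ')
StrictJRel-sym (TI p A≈A') = TI (≐⟨⟩-sym p) (≈-pointwise-sym A≈A')
StrictJRel-sym {π} (H {x} {ρ₀} {Γ₀} {τ₀} {ρ} {Γ} {τ} ρ₀≈ρ p τ₀≈τ) =
  subst (λ z → StrictJRel (↔-sym π) (H (ren π x) ρ Γ τ) (H z ρ₀ Γ₀ τ₀)) (ren⁻¹-ren π x)
        (H (≈-sym ρ₀≈ρ) (≐⟨⟩-sym p) (≈-sym τ₀≈τ))

StrictJRel⇒JRel : ∀ {π J₀ J} → StrictJRel π J₀ J → JRel π J₀ J
StrictJRel⇒JRel (T p σ≈σ')      = at p , σ≈σ'
StrictJRel⇒JRel (TI p A≈A')     = at p , refl A≈A'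
StrictJRel⇒JRel (H ρ≈ρ' p τ≈τ') = ≡.refl , ρ≈ρ' , at p , τ≈τ'

record PremiseRel (J₀ : Judg) (π : Ren) (K₀ K : Judg) : Set where
  constructor premiseRel
  field
    premiseRenaming : Ren
    agrees          : Agree J₀ π premiseRenaming
    related         : StrictJRel premiseRenaming K₀ K

unrenamed : ∀ {J₀ π K₀ K} → StrictJRel π K₀ K → PremiseRel J₀ π K₀ K
unrenamed r = premiseRel _ (λ _ _ → ≡.refl) r

Candidate : Judg → Set
Candidate J = ∃ (Inst J)

Covers : ∀ {J} → Judg → Ren → List (Candidate J) → Set
Covers J₀ π cs = ∀ {ps₀} → Inst J₀ ps₀ → Any (λ (ps , _) → Pointwise (PremiseRel J₀ π) ps₀ ps) cs

absCandidate : ∀ {Γ A τ b} → Bounded Γ b → Candidate (T Γ (A ⇒ τ))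
absCandidate {b = b} bd = _ , abs {x = b} (bd b ≤-refl)

-- A fresh x₀ is matched with b by swapping π x₀ and b, both unused in Γ, so the
-- variables of the goal keep their image under π.
absCandidate-complete : ∀ {Γ A τ b Γ₀ A₀ τ₀ x₀} → Bounded Γ b → (π : Ren) →
  Γ₀ ≐⟨ π ⟩ Γ → A₀ ≋ A → τ₀ ≈ τ → Γ₀ x₀ ≡ [] →
  Pointwise (PremiseRel (T Γ₀ (A₀ ⇒ τ₀)) π) [ T (Γ₀ +ᴱ (x₀ ∶ A₀)) τ₀ ] [ T (Γ +ᴱ (b ∶ A)) τ ]
absCandidate-complete {Γ} {A} {b = b} {Γ₀} {A₀} {x₀ = x₀} bd π Γ₀≐Γ A₀≋A τ₀≈τ Γ₀x₀≡[] =
  premiseRel π' agree (T (≐⟨⟩-+ᴱ (≐⟨⟩-transpose Γ₀≐Γ Γa≡[] Γb≡[])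
                             (≐⟨⟩-∶ (transpose-a a b) A₀≋A)) τ₀≈τ) ∷ []
  where
  a : ℕ
  a = ren π x₀
  π' : Ren
  π' = transposition a b ↔-∘ π
  Γa≡[] : Γ a ≡ []
  Γa≡[] = []-≋-inv (≋-trans (≋-reflexive (sym Γ₀x₀≡[])) (at Γ₀≐Γ x₀))
  Γb≡[] : Γ b ≡ []
  Γb≡[] = bd b ≤-refl
  agree : ∀ y → Γ₀ y ≢ [] → ren π y ≡ transpose a b (ren π y)
  agree y Γ₀y≢[] = sym (transpose-other (λ e → Γπy≢[] (≡.trans (cong Γ e) Γa≡[]))
                                        (λ e → Γπy≢[] (≡.trans (cong Γ e) Γb≡[])))
    where
    Γπy≢[] : Γ (ren π y) ≢ []
    Γπy≢[] = ≐⟨⟩-≢[] Γ₀≐Γ Γ₀y≢[]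

headCandidate : ∀ {Γ' τ} x → Split (Γ' x) → List (Candidate (T Γ' τ))
headCandidate {τ = τ} x ((A , ρ ∷ []) , p) = ifYes (Tgt? ρ τ) λ t → [ _ , head (update-split p) t ]
headCandidate x _ = []

headCandidates : ∀ Γ' τ b → List (Candidate (T Γ' τ))
headCandidates Γ' τ b = concatMap (λ x → concatMap (headCandidate x) (splits (Γ' x))) (downFrom b)

headCandidates-complete : ∀ {Γ' τ b Γ₀' τ₀ Γ₀ x₀ ρ₀} → Bounded Γ' b → (π : Ren) →
  Γ₀' ≐⟨ π ⟩ Γ' → τ₀ ≈ τ → Γ₀' ≐ Γ₀ +ᴱ (x₀ ∶ [ ρ₀ ]) → Tgt ρ₀ τ₀ →
  Any (λ (ps , _) → Pointwise (PremiseRel (T Γ₀' τ₀) π) [ H x₀ ρ₀ Γ₀ τ₀ ] ps) (headCandidates Γ' τ b)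
headCandidates-complete {Γ'} {τ} {b} {Γ₀'} {τ₀} {Γ₀} {x₀} {ρ₀} bd π Γ₀'≐Γ' τ₀≈τ e t₀ =
  concatMap⁺ (λ { ≡.refl → concatMap⁺ (λ {d} → matching d) (splits-complete (Γ' x) split) })
             (∈-downFrom⁺ x<b)
  where
  x : ℕ
  x = ren π x₀
  split : Γ' x ≋ Γ₀ x₀ ++ [ ρ₀ ]
  split = ≋-trans (≋-sym (at Γ₀'≐Γ' x₀)) (≋-trans (e x₀) (≋-reflexive (cong (Γ₀ x₀ ++_) (∶-≡ x₀ [ ρ₀ ]))))
  x<b : x < b
  x<b = bounded-< bd x λ Γ'x≡[] → case proj₂ (++-≋-[]-inv {A = Γ₀ x₀} split Γ'x≡[]) of λ ()
  matching : (d : Split (Γ' x)) → Γ₀ x₀ ≋ proj₁ (proj₁ d) × [ ρ₀ ] ≋ proj₂ (proj₁ d) →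
             Any (λ (ps , _) → Pointwise (PremiseRel (T Γ₀' τ₀) π) [ H x₀ ρ₀ Γ₀ τ₀ ] ps) (headCandidate x d)
  matching ((A , _) , _) (Γ₀x₀≋A , q) with ρ , ≡.refl , ρ≈ρ₀ ← ≋-[-]-inv (≋-sym q) =
    ifYes-complete (Tgt? ρ τ) (Tgt-resp-≈ (≈-sym ρ≈ρ₀) τ₀≈τ t₀)
      λ _ → here (unrenamed (H (≈-sym ρ≈ρ₀) (≐⟨⟩-update π Γ₀'≐Γ' e Γ₀x₀≋A) τ₀≈τ) ∷ [])

UnionSplit : Env → MTy → Set
UnionSplit Γ A = Σ[ ps ∈ List (Env × Ty) ] Γ ≐ sumᴱ (map proj₁ ps) × A ≡ map proj₂ ps

unionSplits : ∀ b Γ → Bounded Γ b → (A : MTy) → List (UnionSplit Γ A)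
unionSplits b Γ bd [] =
  ifYes (allUpTo? (λ z → Γ z ≋? []) b) λ empty-below → [ [] , emptyᴱ-≐ empty-below , ≡.refl ]
  where
  emptyᴱ-≐ : (∀ {z} → z < b → Γ z ≋ []) → Γ ≐ emptyᴱ
  emptyᴱ-≐ empty-below y with b ≤? y
  ... | yes b≤y = ≋-reflexive (bd y b≤y)
  ... | no  b≰y = empty-below (≰⇒> b≰y)
unionSplits b Γ bd (σ ∷ A) =
  concatMap (λ c → map (cons c) (unionSplits b (envʳ c) (boundedʳ c) A)) (envSplits b Γ)
  where
  cons : (c : EnvSplit b Γ) → UnionSplit (envʳ c) A → UnionSplit Γ (σ ∷ A)
  cons c (ps , e , A≡ps) =
    (envˡ c , σ) ∷ ps , (λ y → ≋-trans (EnvSplit-≐ bd c y) (≋-++⁺ˡ (envˡ c y) (e y))) , cong (σ ∷_) A≡ps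

RenamedPremise : Ren → Env × Ty → Env × Ty → Set
RenamedPremise π (Δ₀ , σ₀) (Δ , σ) = Δ₀ ≐⟨ π ⟩ Δ × σ₀ ≈ σ

unionSplits-complete : ∀ b Γ (bd : Bounded Γ b) A {Γ₀ ps₀} (π : Ren) → Γ₀ ≐⟨ π ⟩ Γ →
  Γ₀ ≐ sumᴱ (map proj₁ ps₀) → Pointwise _≈_ (map proj₂ ps₀) A →
  Any (λ (ps , _) → Pointwise (RenamedPremise π) ps₀ ps) (unionSplits b Γ bd A)
unionSplits-complete b Γ bd [] {Γ₀} {[]} π Γ₀≐Γ e [] =
  ifYes-complete (allUpTo? (λ z → Γ z ≋? []) b) empty-below λ _ → here []
  where
  empty-below : ∀ {z} → z < b → Γ z ≋ []
  empty-below {z} _ = ≋-trans (≋-reflexive (cong Γ (sym (ren-ren⁻¹ π z))))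
                              (≋-trans (≋-sym (at Γ₀≐Γ (ren⁻¹ π z))) (e (ren⁻¹ π z)))
unionSplits-complete b Γ bd (σ ∷ A) {Γ₀} {(Δ₀ , σ₀) ∷ ps₀} π Γ₀≐Γ e (σ₀≈σ ∷ ps₀≈A) =
  concatMap⁺ (λ (Δ₀≐Δ , rest≐) → map⁺ (Any.map (λ ps₀≈ps → (Δ₀≐Δ , σ₀≈σ) ∷ ps₀≈ps)
                  (unionSplits-complete b _ _ A π rest≐ (λ _ → ≋-refl) ps₀≈A)))
             (envSplits-complete-renamed bd π Γ₀≐Γ e)

module _ (x : ℕ) (ρ : Ty) {Γ : Env} (τ : Ty) {b : ℕ} (bd : Bounded Γ b) where

  argumentCandidates : ArrowTarget ρ → List (Candidate (H x ρ Γ τ))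
  argumentCandidates (([] , τ') , t) =
    ifYes (τ' ≈? τ) λ τ'≈τ → [ _ , headE (Tgt-resp-≈ ≈-refl (arr ≋-refl τ'≈τ) t) ]
  argumentCandidates ((B'@(_ ∷ _) , τ') , t) =
    ifYes (τ' ≈? τ) λ τ'≈τ → concatMap (λ (B , B'≋B) → map (λ c →
      _ , headS {Γ₁ = envˡ c} {envʳ c} (EnvSplit-≐ bd c) (Tgt-resp-≈ ≈-refl (arr B'≋B τ'≈τ) t) (B≢[] B'≋B))
      (envSplits b Γ)) (permutations B')
    where
    B≢[] : ∀ {B} → B' ≋ B → NonEmpty B
    B≢[] B'≋B B≡[] = case ≋-[]-inv (≋-trans B'≋B (≋-reflexive B≡[])) of λ ()

  spineCandidates : List (Candidate (H x ρ Γ τ))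
  spineCandidates =
    ifYes (ρ ≈? τ) (λ ρ≈τ → [ _ , head0 ρ≈τ ]) ++ concatMap argumentCandidates (arrowTargets ρ)

  spineCandidates-complete : ∀ {J₀} (π : Ren) → StrictJRel π J₀ (H x ρ Γ τ) → Covers J₀ π spineCandidates
  spineCandidates-complete π (H ρ₀≈ρ Γ₀≐Γ τ₀≈τ) (head0 ρ₀≈τ₀) =
    ++⁺ˡ (ifYes-complete (ρ ≈? τ) (≈-trans (≈-sym ρ₀≈ρ) (≈-trans ρ₀≈τ₀ τ₀≈τ)) λ _ → here [])
  spineCandidates-complete π (H ρ₀≈ρ Γ₀≐Γ τ₀≈τ) (headE t₀) =
    ++⁺ʳ _ (concatMap⁺ (λ {c} → matching c) (arrowTargets-complete (Tgt-resp-≈ ρ₀≈ρ ≈-refl t₀)))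
    where
    matching : ∀ c → proj₁ (proj₁ c) ≋ [] × proj₂ (proj₁ c) ≈ _ → Any _ (argumentCandidates c)
    matching (([] , τ') , t) (_ , τ'≈τ₀) =
      ifYes-complete (τ' ≈? τ) (≈-trans τ'≈τ₀ τ₀≈τ) λ _ →
        here (unrenamed (H ρ₀≈ρ Γ₀≐Γ (arr ≋-refl τ₀≈τ)) ∷ [])
    matching ((_ ∷ _ , _) , _) (B'≋[] , _) = case ≋-[]-inv B'≋[] of λ ()
  spineCandidates-complete π (H ρ₀≈ρ Γ₀≐Γ τ₀≈τ) (headS {B = B₀} e t₀ B₀≢[]) =
    ++⁺ʳ _ (concatMap⁺ (λ {c} → matching c) (arrowTargets-complete (Tgt-resp-≈ ρ₀≈ρ ≈-refl t₀)))
    where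
    matching : ∀ c → proj₁ (proj₁ c) ≋ B₀ × proj₂ (proj₁ c) ≈ _ → Any _ (argumentCandidates c)
    matching (([] , _) , _) ([]≋B₀ , _) = ⊥-elim (B₀≢[] ([]-≋-inv []≋B₀))
    matching ((B'@(_ ∷ _) , τ') , t) (B'≋B₀ , τ'≈τ₀) =
      ifYes-complete (τ' ≈? τ) (≈-trans τ'≈τ₀ τ₀≈τ) λ _ →
        concatMap⁺ (λ {(B , _)} B₀≈B → map⁺ (Any.map (λ (Γ₀₁≐Γ₁ , Γ₀₂≐Γ₂) →
                      unrenamed (H ρ₀≈ρ Γ₀₁≐Γ₁ (arr (refl B₀≈B) τ₀≈τ)) ∷ unrenamed (TI Γ₀₂≐Γ₂ B₀≈B) ∷ [])
                      (envSplits-complete-renamed bd π Γ₀≐Γ e)))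
                   (permutations-complete B' (≋-sym B'≋B₀))

candidates : ∀ J {b} → Bounded (env J) b → List (Candidate J)
candidates (T Γ (base a)) {b} bd = headCandidates Γ (base a) b
candidates (T Γ (A ⇒ τ))  {b} bd = absCandidate bd ∷ headCandidates Γ (A ⇒ τ) b
candidates (TI Γ A)       {b} bd = map (λ (ps , e , A≡ps) → _ , union ps e A≡ps) (unionSplits b Γ bd A)
candidates (H x ρ Γ τ)        bd = spineCandidates x ρ τ bd

candidates-complete : ∀ {J b} (bd : Bounded (env J) b) {J₀} (π : Ren) → StrictJRel π J₀ J →
  Covers J₀ π (candidates J bd)
candidates-complete {T Γ _} bd π (T Γ₀≐Γ (arr A₀≋A τ₀≈τ)) (abs Γ₀x₀≡[]) =
  here (absCandidate-complete bd π Γ₀≐Γ A₀≋A τ₀≈τ Γ₀x₀≡[])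
candidates-complete {T Γ (base _)} bd π (T Γ₀≐Γ τ₀≈τ) (head e t) =
  headCandidates-complete bd π Γ₀≐Γ τ₀≈τ e t
candidates-complete {T Γ (_ ⇒ _)} bd π (T Γ₀≐Γ τ₀≈τ) (head e t) =
  there (headCandidates-complete bd π Γ₀≐Γ τ₀≈τ e t)
candidates-complete {TI Γ A} {b} bd π (TI Γ₀≐Γ A₀≈A) (union ps₀ e ≡.refl) =
  map⁺ (Any.map (Pointwise.map⁺ _ _ ∘ Pointwise.map (λ (Δ₀≐Δ , σ₀≈σ) → unrenamed (T Δ₀≐Δ σ₀≈σ)))
                (unionSplits-complete b Γ bd A π Γ₀≐Γ e A₀≈A))
candidates-complete {H x ρ Γ τ} bd π r = spineCandidates-complete x ρ τ bd π r

NoRule : Judg → Set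
NoRule J = ∀ ps → ¬ Inst J ps

noRule? : ∀ J {b} → Bounded (env J) b → Dec (NoRule J)
noRule? J bd with candidates J bd | candidates-complete bd (↔-id ℕ) (StrictJRel-refl J)
... | []          | complete = yes λ _ i → ¬Any[] (complete i)
... | (_ , i) ∷ _ | _        = no λ noRule → noRule _ i

NoRule-transfer : ∀ {π J₀ J b₀} → Bounded (env J₀) b₀ → StrictJRel π J₀ J → NoRule J₀ → NoRule J
NoRule-transfer bd₀ r noRule₀ _ i =
  noRule₀ _ (proj₂ (Any.lookup (candidates-complete bd₀ _ (StrictJRel-sym r) i)))

-- Runs

RunsComplete : (J : Judg) → List (Run J) → Set
RunsComplete J L =
  ∀ {J₀ b₀} (π : Ren) → Bounded (env J₀) b₀ → StrictJRel π J₀ J → (r₀ : Run J₀) → Any (Sim π r₀) L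

CompleteRuns : Judg → Set
CompleteRuns J = Σ (List (Run J)) (RunsComplete J)

choices : ∀ {ps} → All (λ K → List (Run K)) ps → List (All Run ps)
choices []         = [ [] ]
choices (rs ∷ rss) = concatMap (λ r → map (r ∷_) (choices rss)) rs

choices-complete : ∀ {J₀ b₀ π ps₀ ps} → Pointwise (PremiseRel J₀ π) ps₀ ps → (rs₀ : All Run ps₀) →
  All (Smaller b₀ J₀) ps₀ → (rss : All CompleteRuns ps) →
  Any (SimAll J₀ π rs₀) (choices (All.map proj₁ rss))
choices-complete [] [] [] [] = here []
choices-complete (premiseRel π' agree r ∷ rels) (r₀ ∷ rs₀) (smaller _ bd₀ _ ∷ smalls) ((_ , complete) ∷ rss) =
  concatMap⁺ (λ sim → map⁺ (Any.map (λ sims → (π' , agree , sim) ∷ sims)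
                                    (choices-complete rels rs₀ smalls rss)))
             (complete π' bd₀ r r₀)

runs : ∀ {J b} → Bounded (env J) b → Acc Premise J → CompleteRuns J
runs {J} {b} bd (acc rec) = stuckRuns ++ stepRuns , complete
  where
  premiseRuns : ((ps , _) : Candidate J) → All CompleteRuns ps
  premiseRuns (ps , i) = All.tabulate λ K∈ps →
    runs (Smaller.bounded (All.lookup (premises-smaller b bd i) K∈ps)) (rec (ps , i , K∈ps))
  stuckRuns stepRuns : List (Run J)
  stuckRuns = ifYes (noRule? J bd) λ noRule → [ stuck noRule ]
  stepRuns  = concatMap (λ c → map (step (proj₂ c)) (choices (All.map proj₁ (premiseRuns c))))
                        (candidates J bd)
  complete : RunsComplete J (stuckRuns ++ stepRuns)
  complete π bd₀ r (step i₀ rs₀) = ++⁺ʳ stuckRuns (concatMap⁺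
    (λ {c} rels → map⁺ (Any.map (step (StrictJRel⇒JRel r))
                                (choices-complete rels rs₀ (premises-smaller _ bd₀ i₀) (premiseRuns c))))
    (candidates-complete bd π r i₀))
  complete π bd₀ r (stuck noRule₀) =
    ++⁺ˡ (ifYes-complete (noRule? J bd) (NoRule-transfer bd₀ r noRule₀) λ _ →
            here (stuck (StrictJRel⇒JRel r)))

WfJudg⇒bounded : ∀ J → WfJudg J → ∃ (Bounded (env J))
WfJudg⇒bounded (T _ _)     wf = wf
WfJudg⇒bounded (TI _ _)    wf = wf
WfJudg⇒bounded (H _ _ _ _) wf = wf

lemma4p13 : ∀ (J : Judg) → WfJudg J →
    Acc Premise J × Σ (List (Run J)) (λ L → ∀ (r : Run J) → Any (λ r' → r ≅ᴿ r') L)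
lemma4p13 J wf
  with b , bd       ← WfJudg⇒bounded J wf
  with terminates   ← accessible bd (<-wellFounded (measure b J))
  with L , complete ← runs bd terminates =
  terminates , L , λ r → Any.map (λ sim → ↔-id ℕ , (λ _ _ → ≡.refl) , sim)
                                (complete (↔-id ℕ) bd (StrictJRel-refl J) r)
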